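{- Let $k\geq 0$. For $m\geq 0$, let $b_k(m)$ be the number of lattice paths with $2m$ steps, each step an up-step $(1,1)$ or a down-step $(1,-1)$, starting at $(a,k+1)$ and ending at $(a+2m,k+1)$ (for a fixed integer $a$), never passing below the $x$-axis, and having no valley at height $k$. Then $$\sum_{m\geq0} b_k(m)x^m=\frac{C(x)}{1-x\big(R_{k+1}(x)-1\big)C(x)}.$$
   Context: A valley at height $k$ is a point of the path with $y$-coordinate $k$ that is immediately preceded by a down-step and immediately followed by an up-step. $C(x)=\frac{1-\sqrt{1-4x}}{2x}$ is the Catalan generating function. $U_r$ is the Chebyshev polynomial of the second kind, $U_r(\cos\theta)=\frac{\sin((r+1)\theta)}{\sin\theta}$ for $r\geq0$, with $U_{ -1}=0$, and for $k\geq0$, $R_k(x)=\frac{U_{k-1}\left(\frac{1}{2\sqrt{x}}\right)}{\sqrt{x}\,U_k\left(\frac{1}{2\sqrt{x}}\right)}$, a rational function of $x$. -}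

module Defs where

open import Data.Nat using (ℕ; zero; suc; _∸_; _≡ᵇ_) renaming (_*_ to _*ℕ_; _/_ to _/ℕ_)
open import Data.Nat.Combinatorics using (_C_)
open import Data.Integer using (ℤ; +_; _+_; _*_; -_; _-_)
open import Data.Bool using (Bool; true; false; _∧_; not; if_then_else_)
open import Data.List using (List; []; _∷_; map; foldr; upTo; zipWith; _++_)

-- Lattice paths.  A path is a list of steps: true = up-step (1,1),
-- false = down-step (1,-1).  The starting abscissa a is irrelevant.

allWords : ℕ → List (List Bool)
allWords zero    = [] ∷ []
allWords (suc n) = map (true ∷_) (allWords n) ++ map (false ∷_) (allWords n)

-- admissible k h d s :
--   current height is h (a natural number, so ≥ 0), d = "the step just
--   taken was a down-step", s = remaining steps.  The path must never go
--   below the x-axis, must end at height k+1, and must have no valley at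
--   height k (a point at height k preceded by a down-step and followed by
--   an up-step).
admissible : ℕ → ℕ → Bool → List Bool → Bool
admissible k h d []              = h ≡ᵇ suc k
admissible k h d (true ∷ s)      = not (d ∧ (h ≡ᵇ k)) ∧ admissible k (suc h) false s
admissible k zero d (false ∷ s)  = false
admissible k (suc h) d (false ∷ s) = admissible k h true s

countTrue : List Bool → ℕ
countTrue []           = zero
countTrue (true ∷ bs)  = suc (countTrue bs)
countTrue (false ∷ bs) = countTrue bs

b : ℕ → ℕ → ℕ
b k m = countTrue (map (admissible k (suc k) false) (allWords (2 *ℕ m)))

PS : Set
PS = ℕ → ℤ

sumℤ : List ℤ → ℤ
sumℤ = foldr _+_ (+ 0)

_⊛_ : PS → PS → PS
(f ⊛ g) n = sumℤ (map (λ i → f i * g (n ∸ i)) (upTo (suc n)))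

_⊕_ : PS → PS → PS
(f ⊕ g) n = f n + g n

_⊝_ : PS → PS → PS
(f ⊝ g) n = f n - g n

oneS : PS
oneS zero    = + 1
oneS (suc n) = + 0

xS : PS
xS 1 = + 1
xS _ = + 0

-- Multiplicative inverse of a series with constant term 1
-- (coefficients a_n, ..., a_0, most recent first).
invRev : PS → ℕ → List ℤ
invRev f zero    = + 1 ∷ []
invRev f (suc n) =
  (- sumℤ (zipWith _*_ (map (λ i → f (suc i)) (upTo (suc n))) (invRev f n)))
  ∷ invRev f n

headℤ : List ℤ → ℤ
headℤ []      = + 0
headℤ (a ∷ _) = a

invS : PS → PS
invS f n = headℤ (invRev f n)

-- quotient f / g, for g with constant term 1
_⊘_ : PS → PS → PS
f ⊘ g = f ⊛ invS g

-- Catalan generating function C(x) = (1 - sqrt(1-4x))/(2x),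
-- via its Taylor coefficients binom(2n,n)/(n+1).

catalan : ℕ → ℕ
catalan n = ((2 *ℕ n) C n) /ℕ suc n

Cat : PS
Cat n = + catalan n

-- Chebyshev part.  uu j = (√x)^(j-1) · U_{j-1}(1/(2√x)), a polynomial in x:
-- uu 0 = 0 (U_{-1} = 0), uu 1 = 1 (U_0 = 1), and the Chebyshev recurrence
-- U_r(t) = 2t U_{r-1}(t) - U_{r-2}(t) becomes uu (j+2) = uu (j+1) - x·uu j.
uu : ℕ → PS
uu zero          = λ _ → + 0
uu (suc zero)    = oneS
uu (suc (suc j)) = uu (suc j) ⊝ (xS ⊛ uu j)

-- R_k(x) = U_{k-1}(1/(2√x)) / (√x U_k(1/(2√x))) = uu k / uu (k+1)
R : ℕ → PS
R k = uu k ⊘ uu (suc k)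

rhs : ℕ → PS
rhs k = Cat ⊘ (oneS ⊝ ((xS ⊛ (R (suc k) ⊝ oneS)) ⊛ Cat))

{-# OPTIONS --safe #-}
-- Count paths by their length t. Cutting a path from height k + 1 at its first step and at its first
-- return to k + 1 gives B = 1 + t (D + H) B, where D counts first descents by one level, which is
-- t C(t²) by the ballot (reflection) formula, and H counts first ascents from k to k + 1 that start
-- right after a down-step. Because a valley at k is forbidden, H = S_k − t, where S_j counts first
-- ascents from j to j + 1; these satisfy S_0 = t and S_{j+1} = t + t S_j S_{j+1}, which is the
-- recursion of t R_{j+1}(t²). An equation X = c + t A X has only one power-series solution, so with
-- C = 1 + x C² the series B(t) is C/(1 − x (R_{k+1} − 1) C) evaluated at x = t².

module Submission where

open import Defs
open import Data.Nat using (ℕ)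
open import Data.Integer using (+_)
open import Relation.Binary.PropositionalEquality using (_≡_)

-- Ballot and Catalan numbers

module Descent where
  open import Data.Nat
  open import Data.Nat.Properties
  open import Data.Nat.Combinatorics using (_C_; nCk+nC[k+1]≡[n+1]C[k+1]; nCk≡nC[n∸k]; nC1≡n)
  open import Data.Nat.DivMod using (m*n/n≡m)
  open import Data.Nat.Tactic.RingSolver using (solve-∀)
  open import Relation.Binary.PropositionalEquality
  open import Data.Parity.Base using (_⁻¹)
  open import Data.Parity.Properties using (suc-homo-⁻¹)
  open import Data.Empty using (⊥-elim)
  open import Function using (_∘_)
  open ≡-Reasoning

  -- descent h n counts the n-step paths from height h that reach height 0 for the first time at their end.
  descent : ℕ → ℕ → ℕ
  descent zero    zero    = 1
  descent zero    (suc n) = 0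
  descent (suc h) zero    = 0
  descent (suc h) (suc n) = descent (suc (suc h)) n + descent h n

  descent-< : ∀ {h n} → n < h → descent h n ≡ 0
  descent-< {suc h} {zero}  _         = refl
  descent-< {suc h} {suc n} (s≤s n<h) = cong₂ _+_ (descent-< (m<n⇒m<1+n (m<n⇒m<1+n n<h))) (descent-< n<h)

  descent-diag : ∀ h → descent h h ≡ 1
  descent-diag zero    = refl
  descent-diag (suc h) = cong₂ _+_ (descent-< (m<n⇒m<1+n (n<1+n h))) (descent-diag h)

  double : ℕ → ℕ
  double zero    = zero
  double (suc n) = suc (suc (double n))

  double≡n+n : ∀ n → double n ≡ n + n
  double≡n+n zero    = refl
  double≡n+n (suc n) = cong suc (trans (cong suc (double≡n+n n)) (sym (+-suc n n)))

  2*n≡double : ∀ n → 2 * n ≡ double n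
  2*n≡double n = trans (cong (_+_ n) (+-identityʳ n)) (sym (double≡n+n n))

  infixl 6.5 _C⁻_
  _C⁻_ : ℕ → ℕ → ℕ
  n C⁻ zero  = 0
  n C⁻ suc k = n C k

  pascal : ∀ n k → suc n C k ≡ n C⁻ k + n C k
  pascal n zero    = refl
  pascal n (suc k) = sym (nCk+nC[k+1]≡[n+1]C[k+1] n k)

  middle-symmetry : ∀ j → suc (double j) C suc j ≡ suc (double j) C j
  middle-symmetry j = trans (nCk≡nC[n∸k] (s≤s j≤2j)) (cong (suc (double j) C_) 2j∸j≡j)
    where
    j≤2j : j ≤ double j
    j≤2j = subst (j ≤_) (sym (double≡n+n j)) (m≤m+n j j)
    2j∸j≡j : double j ∸ j ≡ j
    2j∸j≡j = trans (cong (_∸ j) (double≡n+n j)) (m+n∸n≡m j j)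

  -- Reflection principle: reflecting a path from h to 0 up to its first visit to −1 gives a path from −h−2 to 0.
  ballot : ∀ j h → descent (suc h) (suc (double j + h)) + (double j + h) C⁻ j ≡ (double j + h) C j
  ballot zero    h = trans (+-identityʳ _) (descent-diag (suc h))
  ballot (suc j) zero = subst (λ N → descent 1 (suc N) + N C⁻ suc j ≡ N C suc j) (sym (+-identityʳ (double (suc j)))) (begin
    descent 2 (suc M) + 0 + suc M C j              ≡⟨ cong₂ _+_ (+-identityʳ (descent 2 (suc M))) (pascal M j) ⟩
    descent 2 (suc M) + (M C⁻ j + M C j)           ≡⟨ +-assoc (descent 2 (suc M)) _ _ ⟨
    descent 2 (suc M) + M C⁻ j + M C j             ≡⟨ cong (_+ M C j) (subst (λ m → descent 2 (suc m) + m C⁻ j ≡ m C j) (+-comm (double j) 1) (ballot j 1)) ⟩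
    M C j + M C j                                  ≡⟨ cong (_+_ (M C j)) (middle-symmetry j) ⟨
    M C j + M C suc j                              ≡⟨ nCk+nC[k+1]≡[n+1]C[k+1] M j ⟩
    suc M C suc j                                  ∎)
    where
    M = suc (double j)
  ballot (suc j) (suc h) = subst (λ N → descent (2 + h) (suc N) + N C⁻ suc j ≡ N C suc j)
                                 (sym (cong (suc ∘ suc) (+-suc (double j) h))) (begin
    descent (3 + h) (suc n) + descent (suc h) (suc n) + suc n C j
      ≡⟨ cong (_+_ (descent (3 + h) (suc n) + descent (suc h) (suc n))) (pascal n j) ⟩
    descent (3 + h) (suc n) + descent (suc h) (suc n) + (n C⁻ j + n C j)
      ≡⟨ interchange (descent (3 + h) (suc n)) (descent (suc h) (suc n)) (n C⁻ j) (n C j) ⟩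
    (descent (3 + h) (suc n) + n C⁻ j) + (descent (suc h) (suc n) + n C j)
      ≡⟨ cong₂ _+_ (subst (λ m → descent (3 + h) (suc m) + m C⁻ j ≡ m C j) double-j-h+2 (ballot j (2 + h)))
                   (ballot (suc j) h) ⟩
    n C j + n C suc j
      ≡⟨ nCk+nC[k+1]≡[n+1]C[k+1] n j ⟩
    suc n C suc j ∎)
    where
    n = suc (suc (double j + h))
    interchange : ∀ a b c d → a + b + (c + d) ≡ (a + c) + (b + d)
    interchange = solve-∀
    double-j-h+2 : double j + (2 + h) ≡ n
    double-j-h+2 = trans (+-suc (double j) (suc h)) (cong suc (+-suc (double j) h))

  absorption : ∀ n k → suc k * (suc n C suc k) ≡ suc n * (n C k)
  absorption zero    zero    = refl
  absorption zero    (suc k) = *-zeroʳ (suc (suc k))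
  absorption (suc n) zero    = trans (+-identityʳ _) (trans (nC1≡n (suc (suc n))) (sym (*-identityʳ (suc (suc n)))))
  absorption (suc n) (suc k) = begin
    suc (suc k) * (suc (suc n) C suc (suc k))        ≡⟨ cong (suc (suc k) *_) (nCk+nC[k+1]≡[n+1]C[k+1] (suc n) (suc k)) ⟨
    suc (suc k) * (X + Y)                            ≡⟨ expand k X Y ⟩
    X + suc k * X + suc (suc k) * Y                  ≡⟨ cong₂ (λ u v → X + u + v) (absorption n k) (absorption n (suc k)) ⟩
    X + suc n * (n C k) + suc n * (n C suc k)        ≡⟨ +-assoc X _ _ ⟩
    X + (suc n * (n C k) + suc n * (n C suc k))      ≡⟨ cong (_+_ X) (*-distribˡ-+ (suc n) (n C k) (n C suc k)) ⟨
    X + suc n * (n C k + n C suc k)                  ≡⟨ cong (λ u → X + suc n * u) (nCk+nC[k+1]≡[n+1]C[k+1] n k) ⟩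
    suc (suc n) * X                                  ∎
    where
    X = suc n C suc k
    Y = suc n C suc (suc k)
    expand : ∀ k X Y → suc (suc k) * (X + Y) ≡ X + suc k * X + suc (suc k) * Y
    expand = solve-∀

  middle-C⁻ : ∀ a → suc a * (double a C⁻ a) ≡ a * (double a C a)
  middle-C⁻ zero    = refl
  middle-C⁻ (suc a) = begin
    suc (suc a) * (D C a)                  ≡⟨ cong (suc (suc a) *_) (nCk≡nC[n∸k] a≤D) ⟩
    suc (suc a) * (D C (D ∸ a))            ≡⟨ cong (λ x → suc (suc a) * (D C x)) D∸a≡2+a ⟩
    suc (suc a) * (D C suc (suc a))        ≡⟨ absorption (suc (double a)) (suc a) ⟩
    D * (suc (double a) C suc a)           ≡⟨ cong (D *_) (middle-symmetry a) ⟩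
    D * (suc (double a) C a)               ≡⟨ absorption (suc (double a)) a ⟨
    suc a * (D C suc a)                    ∎
    where
    D = double (suc a)
    a≤2a : a ≤ double a
    a≤2a = subst (a ≤_) (sym (double≡n+n a)) (m≤m+n a a)
    a≤D : a ≤ D
    a≤D = m≤n⇒m≤1+n (m≤n⇒m≤1+n a≤2a)
    D∸a≡2+a : D ∸ a ≡ suc (suc a)
    D∸a≡2+a = trans (+-∸-assoc 2 a≤2a) (cong (_+_ 2) (trans (cong (_∸ a) (double≡n+n a)) (m+n∸n≡m a a)))

  catalan≡descent : ∀ a → catalan a ≡ descent 1 (suc (2 * a))
  catalan≡descent a = begin
    (2 * a C a) / suc a                    ≡⟨ cong (λ n → (n C a) / suc a) (2*n≡double a) ⟩
    (double a C a) / suc a                 ≡⟨ cong (_/ suc a) (trans (sym scaled) (*-comm (suc a) _)) ⟩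
    (d * suc a) / suc a                    ≡⟨ m*n/n≡m d (suc a) ⟩
    d                                      ≡⟨ cong (λ n → descent 1 (suc n)) (2*n≡double a) ⟨
    descent 1 (suc (2 * a))                ∎
    where
    d = descent 1 (suc (double a))
    scaled : suc a * d ≡ double a C a
    scaled = +-cancelʳ-≡ (a * (double a C a)) _ _ (begin
      suc a * d + a * (double a C a)          ≡⟨ cong (_+_ (suc a * d)) (middle-C⁻ a) ⟨
      suc a * d + suc a * (double a C⁻ a)     ≡⟨ *-distribˡ-+ (suc a) d (double a C⁻ a) ⟨
      suc a * (d + double a C⁻ a)             ≡⟨ cong (λ n → suc a * (descent 1 (suc n) + n C⁻ a)) (+-identityʳ (double a)) ⟨
      suc a * (descent 1 (suc (double a + 0)) + (double a + 0) C⁻ a) ≡⟨ cong (suc a *_) (ballot a 0) ⟩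
      suc a * ((double a + 0) C a)            ≡⟨ cong (λ n → suc a * (n C a)) (+-identityʳ (double a)) ⟩
      suc a * (double a C a)                  ∎)

  descent-parity : ∀ h n → parity h ≢ parity n → descent h n ≡ 0
  descent-parity zero    zero    h≢n = ⊥-elim (h≢n refl)
  descent-parity zero    (suc n) _   = refl
  descent-parity (suc h) zero    _   = refl
  descent-parity (suc h) (suc n) h≢n = cong₂ _+_ (descent-parity (suc (suc h)) n h≢n′) (descent-parity h n h≢n′)
    where
    h≢n′ : parity h ≢ parity n
    h≢n′ h≡n = h≢n (trans (sym (suc-homo-⁻¹ (suc h))) (trans (cong _⁻¹ h≡n) (suc-homo-⁻¹ (suc n))))

open import Data.Nat using (zero; suc; _∸_; _≡ᵇ_; _≤_; _<_; z≤n; s≤s) renaming (_+_ to _+ℕ_; _*_ to _*ℕ_)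
open import Data.Integer using (ℤ; -[1+_]; _+_; _*_; -_; _-_; +-*-rawRing)
open import Relation.Binary.PropositionalEquality using (_≢_; _≗_; refl; sym; trans; cong; cong₂; subst; module ≡-Reasoning)

import Data.Nat.Properties as ℕ
import Data.Integer.Properties as ℤ
open import Algebra.Bundles using (CommutativeRing)
import Algebra.Construct.Pointwise as Pointwise
import Algebra.Solver.Ring.AlmostCommutativeRing as ACR
import Algebra.Solver.Ring
import Relation.Binary.Reasoning.Setoid
open import Data.List using (List; []; _∷_; _++_; map; zipWith; applyUpTo)
open import Data.List.Properties using (map-upTo; map-++; map-∘)
open import Data.Bool using (Bool; true; false; _∧_; not; if_then_else_)
open import Data.Integer.Tactic.RingSolver using (solve-∀)
open import Data.Maybe using (Maybe; just; nothing)
open import Data.Product using (_,_)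
open import Function using (_∘_)
open import Level using (0ℓ)
open import Relation.Nullary using (yes; no)
open import Relation.Nullary.Decidable using (dec-true; dec-false)
open import Data.Bool.Properties using (∧-zeroʳ)
open import Data.Sum using (inj₁; inj₂)
open import Data.Parity.Base using (0ℙ; 1ℙ)
import Data.Parity.Properties as Parity

-- Formal power series

⊛-applyUpTo : ∀ f g n → (f ⊛ g) n ≡ sumℤ (applyUpTo (λ i → f i * g (n ∸ i)) (suc n))
⊛-applyUpTo f g n = cong sumℤ (map-upTo (λ i → f i * g (n ∸ i)) (suc n))

⊛-suc : ∀ f g n → (f ⊛ g) (suc n) ≡ f 0 * g (suc n) + ((f ∘ suc) ⊛ g) n
⊛-suc f g n = trans (⊛-applyUpTo f g (suc n)) (cong (λ s → f 0 * g (suc n) + s) (sym (⊛-applyUpTo (f ∘ suc) g n)))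

⊛-suc-headless : ∀ {f} g n → f 0 ≡ + 0 → (f ⊛ g) (suc n) ≡ ((f ∘ suc) ⊛ g) n
⊛-suc-headless {f} g n f0≡0 = trans (⊛-suc f g n) (trans (cong (λ a → a * g (suc n) + ((f ∘ suc) ⊛ g) n) f0≡0) (ℤ.+-identityˡ _))

⊛-cong : ∀ {f f′ g g′} → f ≗ f′ → g ≗ g′ → (f ⊛ g) ≗ (f′ ⊛ g′)
⊛-cong {f} {f′} {g} {g′} f≗f′ g≗g′ zero = cong (λ a → a + + 0) (cong₂ _*_ (f≗f′ 0) (g≗g′ 0))
⊛-cong {f} {f′} {g} {g′} f≗f′ g≗g′ (suc n) = begin
  (f ⊛ g) (suc n)                          ≡⟨ ⊛-suc f g n ⟩
  f 0 * g (suc n) + ((f ∘ suc) ⊛ g) n      ≡⟨ cong₂ _+_ (cong₂ _*_ (f≗f′ 0) (g≗g′ (suc n))) (⊛-cong (f≗f′ ∘ suc) g≗g′ n) ⟩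
  f′ 0 * g′ (suc n) + ((f′ ∘ suc) ⊛ g′) n  ≡⟨ sym (⊛-suc f′ g′ n) ⟩
  (f′ ⊛ g′) (suc n)                        ∎
  where open ≡-Reasoning

⊛-congˡ : ∀ f {g g′} → g ≗ g′ → (f ⊛ g) ≗ (f ⊛ g′)
⊛-congˡ f = ⊛-cong {f} (λ _ → refl)

⊛-congʳ : ∀ g {f f′} → f ≗ f′ → (f ⊛ g) ≗ (f′ ⊛ g)
⊛-congʳ g f≗f′ = ⊛-cong {g = g} f≗f′ (λ _ → refl)

zeroS : PS
zeroS _ = + 0

⊛-zeroˡ : ∀ g → (zeroS ⊛ g) ≗ zeroS
⊛-zeroˡ g zero    = refl
⊛-zeroˡ g (suc n) = trans (⊛-suc zeroS g n) (trans (ℤ.+-identityˡ _) (⊛-zeroˡ g n))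

⊛-identityˡ : ∀ f → (oneS ⊛ f) ≗ f
⊛-identityˡ f zero    = trans (ℤ.+-identityʳ _) (ℤ.*-identityˡ (f 0))
⊛-identityˡ f (suc n) = begin
  (oneS ⊛ f) (suc n)                    ≡⟨ ⊛-suc oneS f n ⟩
  + 1 * f (suc n) + (zeroS ⊛ f) n       ≡⟨ cong₂ _+_ (ℤ.*-identityˡ (f (suc n))) (⊛-zeroˡ f n) ⟩
  f (suc n) + + 0                       ≡⟨ ℤ.+-identityʳ _ ⟩
  f (suc n)                             ∎
  where open ≡-Reasoning

⊛-guarded : ∀ c f g n → ((λ i → if c then + 0 else f i) ⊛ g) n ≡ (if c then + 0 else (f ⊛ g) n)
⊛-guarded true  f g n = ⊛-zeroˡ g n
⊛-guarded false f g n = refl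

⊛-scaleˡ : ∀ a f g n → ((λ i → a * f i) ⊛ g) n ≡ a * (f ⊛ g) n
⊛-scaleˡ a f g zero    = ℤ-identity a (f 0) (g 0)
  where ℤ-identity : ∀ a b c → a * b * c + + 0 ≡ a * (b * c + + 0)
        ℤ-identity = solve-∀
⊛-scaleˡ a f g (suc n) = begin
  ((λ i → a * f i) ⊛ g) (suc n)                        ≡⟨ ⊛-suc (λ i → a * f i) g n ⟩
  a * f 0 * g (suc n) + ((λ i → a * f (suc i)) ⊛ g) n  ≡⟨ cong (λ s → a * f 0 * g (suc n) + s) (⊛-scaleˡ a (f ∘ suc) g n) ⟩
  a * f 0 * g (suc n) + a * ((f ∘ suc) ⊛ g) n          ≡⟨ cong (_+ a * ((f ∘ suc) ⊛ g) n) (ℤ.*-assoc a (f 0) (g (suc n))) ⟩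
  a * (f 0 * g (suc n)) + a * ((f ∘ suc) ⊛ g) n        ≡⟨ sym (ℤ.*-distribˡ-+ a _ _) ⟩
  a * (f 0 * g (suc n) + ((f ∘ suc) ⊛ g) n)            ≡⟨ cong (a *_) (sym (⊛-suc f g n)) ⟩
  a * (f ⊛ g) (suc n)                                  ∎
  where open ≡-Reasoning

⊛-distribʳ : ∀ h f g → ((f ⊕ g) ⊛ h) ≗ ((f ⊛ h) ⊕ (g ⊛ h))
⊛-distribʳ h f g zero    = ℤ-identity (f 0) (g 0) (h 0)
  where ℤ-identity : ∀ a b c → (a + b) * c + + 0 ≡ (a * c + + 0) + (b * c + + 0)
        ℤ-identity = solve-∀
⊛-distribʳ h f g (suc n) = begin
  ((f ⊕ g) ⊛ h) (suc n)                                          ≡⟨ ⊛-suc (f ⊕ g) h n ⟩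
  (f 0 + g 0) * h (suc n) + (((f ∘ suc) ⊕ (g ∘ suc)) ⊛ h) n      ≡⟨ cong (λ s → (f 0 + g 0) * h (suc n) + s) (⊛-distribʳ h (f ∘ suc) (g ∘ suc) n) ⟩
  (f 0 + g 0) * h (suc n) + (((f ∘ suc) ⊛ h) n + ((g ∘ suc) ⊛ h) n) ≡⟨ ℤ-identity (f 0) (g 0) (h (suc n)) _ _ ⟩
  (f 0 * h (suc n) + ((f ∘ suc) ⊛ h) n) + (g 0 * h (suc n) + ((g ∘ suc) ⊛ h) n) ≡⟨ sym (cong₂ _+_ (⊛-suc f h n) (⊛-suc g h n)) ⟩
  ((f ⊛ h) ⊕ (g ⊛ h)) (suc n)                                    ∎
  where
  open ≡-Reasoning
  ℤ-identity : ∀ a b c d e → (a + b) * c + (d + e) ≡ (a * c + d) + (b * c + e)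
  ℤ-identity = solve-∀

⊛-snoc : ∀ f g n → (f ⊛ g) (suc n) ≡ (f ⊛ (g ∘ suc)) n + f (suc n) * g 0
⊛-snoc f g zero    = ℤ-identity (f 0 * g 1) (f 1 * g 0)
  where ℤ-identity : ∀ a b → a + (b + + 0) ≡ a + + 0 + b
        ℤ-identity = solve-∀
⊛-snoc f g (suc n) = begin
  (f ⊛ g) (suc (suc n))                                                   ≡⟨ ⊛-suc f g (suc n) ⟩
  f 0 * g (suc (suc n)) + ((f ∘ suc) ⊛ g) (suc n)                         ≡⟨ cong (λ s → f 0 * g (suc (suc n)) + s) (⊛-snoc (f ∘ suc) g n) ⟩
  f 0 * g (suc (suc n)) + (((f ∘ suc) ⊛ (g ∘ suc)) n + f (suc (suc n)) * g 0) ≡⟨ sym (ℤ.+-assoc (f 0 * g (suc (suc n))) _ _) ⟩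
  f 0 * g (suc (suc n)) + ((f ∘ suc) ⊛ (g ∘ suc)) n + f (suc (suc n)) * g 0   ≡⟨ cong (_+ f (suc (suc n)) * g 0) (sym (⊛-suc f (g ∘ suc) n)) ⟩
  (f ⊛ (g ∘ suc)) (suc n) + f (suc (suc n)) * g 0                         ∎
  where open ≡-Reasoning

⊛-comm : ∀ f g → (f ⊛ g) ≗ (g ⊛ f)
⊛-comm f g zero    = cong (_+ + 0) (ℤ.*-comm (f 0) (g 0))
⊛-comm f g (suc n) = begin
  (f ⊛ g) (suc n)                          ≡⟨ ⊛-suc f g n ⟩
  f 0 * g (suc n) + ((f ∘ suc) ⊛ g) n      ≡⟨ cong₂ _+_ (ℤ.*-comm (f 0) (g (suc n))) (⊛-comm (f ∘ suc) g n) ⟩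
  g (suc n) * f 0 + (g ⊛ (f ∘ suc)) n      ≡⟨ ℤ.+-comm (g (suc n) * f 0) _ ⟩
  (g ⊛ (f ∘ suc)) n + g (suc n) * f 0      ≡⟨ sym (⊛-snoc g f n) ⟩
  (g ⊛ f) (suc n)                          ∎
  where open ≡-Reasoning

⊛-assoc : ∀ f g h → ((f ⊛ g) ⊛ h) ≗ (f ⊛ (g ⊛ h))
⊛-assoc f g h zero    = ℤ-identity (f 0) (g 0) (h 0)
  where ℤ-identity : ∀ a b c → (a * b + + 0) * c + + 0 ≡ a * (b * c + + 0) + + 0
        ℤ-identity = solve-∀
⊛-assoc f g h (suc n) = begin
  ((f ⊛ g) ⊛ h) (suc n)
    ≡⟨ ⊛-suc (f ⊛ g) h n ⟩
  (f ⊛ g) 0 * h (suc n) + (((f ⊛ g) ∘ suc) ⊛ h) n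
    ≡⟨ cong (λ s → (f ⊛ g) 0 * h (suc n) + s) (⊛-congʳ h (⊛-suc f g) n) ⟩
  (f ⊛ g) 0 * h (suc n) + (((λ i → f 0 * g (suc i)) ⊕ ((f ∘ suc) ⊛ g)) ⊛ h) n
    ≡⟨ cong (λ s → (f ⊛ g) 0 * h (suc n) + s) (⊛-distribʳ h (λ i → f 0 * g (suc i)) ((f ∘ suc) ⊛ g) n) ⟩
  (f ⊛ g) 0 * h (suc n) + (((λ i → f 0 * g (suc i)) ⊛ h) n + (((f ∘ suc) ⊛ g) ⊛ h) n)
    ≡⟨ cong (λ s → (f ⊛ g) 0 * h (suc n) + s) (cong₂ _+_ (⊛-scaleˡ (f 0) (g ∘ suc) h n) (⊛-assoc (f ∘ suc) g h n)) ⟩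
  (f 0 * g 0 + + 0) * h (suc n) + (f 0 * ((g ∘ suc) ⊛ h) n + ((f ∘ suc) ⊛ (g ⊛ h)) n)
    ≡⟨ ℤ-identity (f 0) (g 0) (h (suc n)) _ _ ⟩
  f 0 * (g 0 * h (suc n) + ((g ∘ suc) ⊛ h) n) + ((f ∘ suc) ⊛ (g ⊛ h)) n
    ≡⟨ cong (λ s → f 0 * s + ((f ∘ suc) ⊛ (g ⊛ h)) n) (sym (⊛-suc g h n)) ⟩
  f 0 * (g ⊛ h) (suc n) + ((f ∘ suc) ⊛ (g ⊛ h)) n
    ≡⟨ sym (⊛-suc f (g ⊛ h) n) ⟩
  (f ⊛ (g ⊛ h)) (suc n) ∎
  where
  open ≡-Reasoning
  ℤ-identity : ∀ a b c d e → (a * b + + 0) * c + (a * d + e) ≡ a * (b * c + d) + e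
  ℤ-identity = solve-∀

negS : PS → PS
negS f n = - f n

PS-commutativeRing : CommutativeRing 0ℓ 0ℓ
PS-commutativeRing = record
  { Carrier           = PS
  ; _≈_               = _≗_
  ; _+_               = _⊕_
  ; _*_               = _⊛_
  ; -_                = negS
  ; 0#                = zeroS
  ; 1#                = oneS
  ; isCommutativeRing = record
    { isRing = record
      { +-isAbelianGroup = Pointwise.isAbelianGroup ℕ ℤ.+-0-isAbelianGroup
      ; *-cong           = ⊛-cong
      ; *-assoc          = ⊛-assoc
      ; *-identity       = ⊛-identityˡ , λ f n → trans (⊛-comm f oneS n) (⊛-identityˡ f n)
      ; distrib          = (λ h f g n → trans (⊛-comm h (f ⊕ g) n) (trans (⊛-distribʳ h f g n) (cong₂ _+_ (⊛-comm f h n) (⊛-comm g h n))))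
                         , ⊛-distribʳ
      }
    ; *-comm = ⊛-comm
    }
  }

-- The solver's constant (+ 1) must evaluate to oneS itself, so that its equations mention oneS literally.
constS : ℤ → PS
constS (+ 1) = oneS
constS c     = λ { zero → c ; (suc _) → + 0 }

constS-zero : ∀ c → constS c 0 ≡ c
constS-zero (+ 0)           = refl
constS-zero (+ 1)           = refl
constS-zero (+ suc (suc _)) = refl
constS-zero -[1+ _ ]        = refl

constS-suc : ∀ c n → constS c (suc n) ≡ + 0
constS-suc (+ 0)           n = refl
constS-suc (+ 1)           n = refl
constS-suc (+ suc (suc _)) n = refl
constS-suc -[1+ _ ]        n = refl

constS-unique : ∀ c {f} → f 0 ≡ c → (∀ n → f (suc n) ≡ + 0) → constS c ≗ f
constS-unique c f0≡c _    zero    = trans (constS-zero c) (sym f0≡c)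
constS-unique c _    tail (suc n) = trans (constS-suc c n) (sym (tail n))

constS-morphism : ACR._-Raw-AlmostCommutative⟶_ +-*-rawRing (ACR.fromCommutativeRing PS-commutativeRing)
constS-morphism = record
  { ⟦_⟧    = constS
  ; +-homo = λ a b → constS-unique (a + b) (cong₂ _+_ (constS-zero a) (constS-zero b))
                                           (λ n → cong₂ _+_ (constS-suc a n) (constS-suc b n))
  ; *-homo = λ a b → constS-unique (a * b) (trans (ℤ.+-identityʳ _) (cong₂ _*_ (constS-zero a) (constS-zero b)))
                                           (λ n → ⊛-const-suc a b n)
  ; -‿homo = λ a → constS-unique (- a) (cong -_ (constS-zero a)) (λ n → cong -_ (constS-suc a n))
  ; 0-homo = constS-unique (+ 0) refl (λ _ → refl)
  ; 1-homo = λ _ → refl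
  }
  where
  ⊛-const-suc : ∀ a b n → (constS a ⊛ constS b) (suc n) ≡ + 0
  ⊛-const-suc a b n = begin
    (constS a ⊛ constS b) (suc n)                                 ≡⟨ ⊛-suc (constS a) (constS b) n ⟩
    constS a 0 * constS b (suc n) + ((constS a ∘ suc) ⊛ constS b) n ≡⟨ cong₂ _+_ (cong (constS a 0 *_) (constS-suc b n))
                                                                                  (⊛-congʳ (constS b) (constS-suc a) n) ⟩
    constS a 0 * + 0 + (zeroS ⊛ constS b) n                       ≡⟨ cong₂ _+_ (ℤ.*-zeroʳ (constS a 0)) (⊛-zeroˡ (constS b) n) ⟩
    + 0                                                           ∎
    where open ≡-Reasoning

constS-≟ : ∀ a b → Maybe (constS a ≗ constS b)
constS-≟ a b with a ℤ.≟ b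
... | yes refl = just (λ _ → refl)
... | no _     = nothing

module PS-Solver = Algebra.Solver.Ring +-*-rawRing (ACR.fromCommutativeRing PS-commutativeRing) constS-morphism constS-≟
open PS-Solver using (solve; _:=_; _:+_; _:*_; _:-_; con)

module PS = CommutativeRing PS-commutativeRing
module ≗-Reasoning = Relation.Binary.Reasoning.Setoid PS.setoid

xS-suc : ∀ n → xS (suc n) ≡ oneS n
xS-suc zero    = refl
xS-suc (suc n) = refl

xS⊛-suc : ∀ f n → (xS ⊛ f) (suc n) ≡ f n
xS⊛-suc f n = begin
  (xS ⊛ f) (suc n)                 ≡⟨ ⊛-suc xS f n ⟩
  + 0 + ((xS ∘ suc) ⊛ f) n         ≡⟨ ℤ.+-identityˡ _ ⟩
  ((xS ∘ suc) ⊛ f) n               ≡⟨ ⊛-congʳ f xS-suc n ⟩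
  (oneS ⊛ f) n                     ≡⟨ ⊛-identityˡ f n ⟩
  f n                              ∎
  where open ≡-Reasoning

xS⊛-cancel : ∀ {f g} → (xS ⊛ f) ≗ (xS ⊛ g) → f ≗ g
xS⊛-cancel {f} {g} xf≗xg n = trans (sym (xS⊛-suc f n)) (trans (xf≗xg (suc n)) (xS⊛-suc g n))

≗-head-tail : ∀ {X} c Y → X 0 ≡ c 0 → (∀ n → X (suc n) ≡ c (suc n) + Y n) → X ≗ (c ⊕ (xS ⊛ Y))
≗-head-tail c Y head _    zero    = trans head (sym (ℤ.+-identityʳ (c 0)))
≗-head-tail c Y _    tail (suc n) = trans (tail n) (cong (λ s → c (suc n) + s) (sym (xS⊛-suc Y n)))

≗-xS⊛ : ∀ {X Y} → X 0 ≡ + 0 → (∀ n → X (suc n) ≡ Y n) → X ≗ (xS ⊛ Y)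
≗-xS⊛         head _    zero    = head
≗-xS⊛ {Y = Y} _    tail (suc n) = trans (tail n) (sym (xS⊛-suc Y n))

⊛-vanishing : ∀ f g n → (∀ i → i ≤ n → g i ≡ + 0) → (f ⊛ g) n ≡ + 0
⊛-vanishing f g zero    g≡0 = trans (cong (λ a → f 0 * a + + 0) (g≡0 0 z≤n)) (cong (_+ + 0) (ℤ.*-zeroʳ (f 0)))
⊛-vanishing f g (suc n) g≡0 = begin
  (f ⊛ g) (suc n)                      ≡⟨ ⊛-suc f g n ⟩
  f 0 * g (suc n) + ((f ∘ suc) ⊛ g) n  ≡⟨ cong₂ _+_ (cong (f 0 *_) (g≡0 (suc n) ℕ.≤-refl))
                                                    (⊛-vanishing (f ∘ suc) g n (λ i i≤n → g≡0 i (ℕ.m≤n⇒m≤1+n i≤n))) ⟩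
  f 0 * + 0 + + 0                      ≡⟨ cong (_+ + 0) (ℤ.*-zeroʳ (f 0)) ⟩
  + 0                                  ∎
  where open ≡-Reasoning

-- The coefficient of x^(n+1) in x·A·D only involves D 0, …, D n.
xS⊛-fixpoint-zero : ∀ {A D} → D ≗ (xS ⊛ (A ⊛ D)) → D ≗ zeroS
xS⊛-fixpoint-zero {A} {D} D≗xAD n = below n n ℕ.≤-refl
  where
  below : ∀ n m → m ≤ n → D m ≡ + 0
  below _       zero    _         = D≗xAD 0
  below (suc n) (suc m) (s≤s m≤n) = trans (trans (D≗xAD (suc m)) (xS⊛-suc (A ⊛ D) m))
                                          (⊛-vanishing A D m (λ i i≤m → below n i (ℕ.≤-trans i≤m m≤n)))

xS⊛-fixpoint-unique : ∀ {X Y} c A → X ≗ (c ⊕ (xS ⊛ (A ⊛ X))) → Y ≗ (c ⊕ (xS ⊛ (A ⊛ Y))) → X ≗ Y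
xS⊛-fixpoint-unique {X} {Y} c A X≗ Y≗ n = ℤ.i-j≡0⇒i≡j (X n) (Y n) (xS⊛-fixpoint-zero {A} difference n)
  where
  open ≗-Reasoning
  difference : (X ⊝ Y) ≗ (xS ⊛ (A ⊛ (X ⊝ Y)))
  difference = begin
    X ⊝ Y                                              ≈⟨ PS.+-cong X≗ (PS.-‿cong Y≗) ⟩
    (c ⊕ (xS ⊛ (A ⊛ X))) ⊝ (c ⊕ (xS ⊛ (A ⊛ Y)))        ≈⟨ solve 5 (λ c x A X Y → (c :+ x :* (A :* X)) :- (c :+ x :* (A :* Y))
                                                                           := x :* (A :* (X :- Y))) (λ _ → refl) c xS A X Y ⟩
    xS ⊛ (A ⊛ (X ⊝ Y))                                 ∎

invS-suc : ∀ f n → invS f (suc n) ≡ - ((f ∘ suc) ⊛ invS f) n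
invS-suc f n = cong -_ (trans (invRev-sum (f ∘ suc) (λ i → i) n) (sym (⊛-applyUpTo (f ∘ suc) (invS f) n)))
  where
  invRev-sum : ∀ q g n → sumℤ (zipWith _*_ (map q (applyUpTo g (suc n))) (invRev f n))
                       ≡ sumℤ (applyUpTo (λ i → q (g i) * invS f (n ∸ i)) (suc n))
  invRev-sum q g zero    = refl
  invRev-sum q g (suc n) = cong (λ s → q (g 0) * invS f (suc n) + s) (invRev-sum q (g ∘ suc) n)

⊛-invS : ∀ {f} → f 0 ≡ + 1 → (f ⊛ invS f) ≗ oneS
⊛-invS {f} f0≡1 zero    = cong (λ a → a * + 1 + + 0) f0≡1
⊛-invS {f} f0≡1 (suc n) = begin
  (f ⊛ invS f) (suc n)                           ≡⟨ ⊛-suc f (invS f) n ⟩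
  f 0 * invS f (suc n) + ((f ∘ suc) ⊛ invS f) n  ≡⟨ cong₂ (λ a b → a * b + ((f ∘ suc) ⊛ invS f) n) f0≡1 (invS-suc f n) ⟩
  + 1 * - s + s                                  ≡⟨ cong (_+ s) (ℤ.*-identityˡ (- s)) ⟩
  - s + s                                        ≡⟨ ℤ.+-inverseˡ s ⟩
  + 0                                            ∎
  where
  open ≡-Reasoning
  s = ((f ∘ suc) ⊛ invS f) n

⊘-cancel : ∀ {f g} → g 0 ≡ + 1 → ((f ⊘ g) ⊛ g) ≗ f
⊘-cancel {f} {g} g0≡1 = begin
  (f ⊛ invS g) ⊛ g    ≈⟨ PS.*-assoc f (invS g) g ⟩
  f ⊛ (invS g ⊛ g)    ≈⟨ ⊛-congˡ f (⊛-comm (invS g) g) ⟩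
  f ⊛ (g ⊛ invS g)    ≈⟨ ⊛-congˡ f (⊛-invS {g} g0≡1) ⟩
  f ⊛ oneS            ≈⟨ PS.*-identityʳ f ⟩
  f                   ∎
  where open ≗-Reasoning

⊘-unique : ∀ {f g h} → g 0 ≡ + 1 → (h ⊛ g) ≗ f → h ≗ (f ⊘ g)
⊘-unique {f} {g} {h} g0≡1 hg≗f = begin
  h                   ≈⟨ PS.*-identityʳ h ⟨
  h ⊛ oneS            ≈⟨ ⊛-congˡ h (⊛-invS {g} g0≡1) ⟨
  h ⊛ (g ⊛ invS g)    ≈⟨ PS.*-assoc h g (invS g) ⟨
  (h ⊛ g) ⊛ invS g    ≈⟨ ⊛-congʳ (invS g) hg≗f ⟩
  f ⊛ invS g          ∎
  where open ≗-Reasoning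

-- Substituting x² for x

dilate : PS → PS
dilate f zero          = f 0
dilate f (suc zero)    = + 0
dilate f (suc (suc n)) = dilate (f ∘ suc) n

dilate-even : ∀ f a → dilate f (2 *ℕ a) ≡ f a
dilate-even f zero    = refl
dilate-even f (suc a) rewrite ℕ.*-suc 2 a = dilate-even (f ∘ suc) a

dilate-injective : ∀ {f g} → dilate f ≗ dilate g → f ≗ g
dilate-injective {f} {g} df≗dg a = trans (sym (dilate-even f a)) (trans (df≗dg (2 *ℕ a)) (dilate-even g a))

≗-dilate : ∀ {g f} → (∀ a → g (2 *ℕ a) ≡ f a) → (∀ a → g (suc (2 *ℕ a)) ≡ + 0) → g ≗ dilate f
≗-dilate even odd zero          = even 0
≗-dilate even odd (suc zero)    = odd 0
≗-dilate {g} {f} even odd (suc (suc n)) = ≗-dilate {g ∘ suc ∘ suc} {f ∘ suc} even′ odd′ n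
  where
  even′ : ∀ a → g (suc (suc (2 *ℕ a))) ≡ f (suc a)
  even′ a = subst (λ m → g m ≡ f (suc a)) (ℕ.*-suc 2 a) (even (suc a))
  odd′ : ∀ a → g (suc (suc (suc (2 *ℕ a)))) ≡ + 0
  odd′ a = subst (λ m → g (suc m) ≡ + 0) (ℕ.*-suc 2 a) (odd (suc a))

dilate-cong : ∀ {f g} → f ≗ g → dilate f ≗ dilate g
dilate-cong f≗g zero          = f≗g 0
dilate-cong f≗g (suc zero)    = refl
dilate-cong f≗g (suc (suc n)) = dilate-cong (f≗g ∘ suc) n

dilate-zeroS : dilate zeroS ≗ zeroS
dilate-zeroS zero          = refl
dilate-zeroS (suc zero)    = refl
dilate-zeroS (suc (suc n)) = dilate-zeroS n

dilate-oneS : dilate oneS ≗ oneS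
dilate-oneS zero          = refl
dilate-oneS (suc zero)    = refl
dilate-oneS (suc (suc n)) = dilate-zeroS n

dilate-xS : dilate xS ≗ (xS ⊛ xS)
dilate-xS zero          = refl
dilate-xS (suc zero)    = sym (xS⊛-suc xS 0)
dilate-xS (suc (suc n)) = begin
  dilate (xS ∘ suc) n      ≡⟨ dilate-cong xS-suc n ⟩
  dilate oneS n            ≡⟨ dilate-oneS n ⟩
  oneS n                   ≡⟨ sym (xS-suc n) ⟩
  xS (suc n)               ≡⟨ sym (xS⊛-suc xS (suc n)) ⟩
  (xS ⊛ xS) (suc (suc n))  ∎
  where open ≡-Reasoning

dilate-⊕ : ∀ f g → dilate (f ⊕ g) ≗ (dilate f ⊕ dilate g)
dilate-⊕ f g zero          = refl
dilate-⊕ f g (suc zero)    = refl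
dilate-⊕ f g (suc (suc n)) = dilate-⊕ (f ∘ suc) (g ∘ suc) n

dilate-⊝ : ∀ f g → dilate (f ⊝ g) ≗ (dilate f ⊝ dilate g)
dilate-⊝ f g zero          = refl
dilate-⊝ f g (suc zero)    = refl
dilate-⊝ f g (suc (suc n)) = dilate-⊝ (f ∘ suc) (g ∘ suc) n

dilate-scale : ∀ c f n → dilate (λ i → c * f i) n ≡ c * dilate f n
dilate-scale c f zero          = refl
dilate-scale c f (suc zero)    = sym (ℤ.*-zeroʳ c)
dilate-scale c f (suc (suc n)) = dilate-scale c (f ∘ suc) n

dilate-⊛ : ∀ f g → dilate (f ⊛ g) ≗ (dilate f ⊛ dilate g)
dilate-⊛ f g zero          = refl
dilate-⊛ f g (suc zero)    = sym (cong (_+ + 0) (ℤ.*-zeroʳ (f 0)))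
dilate-⊛ f g (suc (suc n)) = begin
  dilate ((f ⊛ g) ∘ suc) n
    ≡⟨ dilate-cong (⊛-suc f g) n ⟩
  dilate ((λ i → f 0 * g (suc i)) ⊕ ((f ∘ suc) ⊛ g)) n
    ≡⟨ dilate-⊕ (λ i → f 0 * g (suc i)) ((f ∘ suc) ⊛ g) n ⟩
  dilate (λ i → f 0 * g (suc i)) n + dilate ((f ∘ suc) ⊛ g) n
    ≡⟨ cong₂ _+_ (dilate-scale (f 0) (g ∘ suc) n) (dilate-⊛ (f ∘ suc) g n) ⟩
  f 0 * dilate (g ∘ suc) n + (dilate (f ∘ suc) ⊛ dilate g) n
    ≡⟨ cong (λ s → f 0 * dilate (g ∘ suc) n + s) (sym (trans (⊛-suc (dilate f ∘ suc) (dilate g) n) (ℤ.+-identityˡ _))) ⟩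
  f 0 * dilate (g ∘ suc) n + ((dilate f ∘ suc) ⊛ dilate g) (suc n)
    ≡⟨ sym (⊛-suc (dilate f) (dilate g) (suc n)) ⟩
  (dilate f ⊛ dilate g) (suc (suc n)) ∎
  where open ≡-Reasoning

dilate-1+x⊛ : ∀ E F → dilate (oneS ⊕ (xS ⊛ (E ⊛ F))) ≗ (oneS ⊕ (xS ⊛ ((xS ⊛ dilate E) ⊛ dilate F)))
dilate-1+x⊛ E F = begin
  dilate (oneS ⊕ (xS ⊛ (E ⊛ F)))                   ≈⟨ dilate-⊕ oneS (xS ⊛ (E ⊛ F)) ⟩
  dilate oneS ⊕ dilate (xS ⊛ (E ⊛ F))              ≈⟨ PS.+-cong dilate-oneS (dilate-⊛ xS (E ⊛ F)) ⟩
  oneS ⊕ (dilate xS ⊛ dilate (E ⊛ F))              ≈⟨ PS.+-congˡ {oneS} (PS.*-cong dilate-xS (dilate-⊛ E F)) ⟩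
  oneS ⊕ ((xS ⊛ xS) ⊛ (dilate E ⊛ dilate F))       ≈⟨ solve 3 (λ x e f → con (+ 1) :+ (x :* x) :* (e :* f) := con (+ 1) :+ x :* ((x :* e) :* f))
                                                               (λ _ → refl) xS (dilate E) (dilate F) ⟩
  oneS ⊕ (xS ⊛ ((xS ⊛ dilate E) ⊛ dilate F))       ∎
  where open ≗-Reasoning

-- The series C, R_k and the right-hand side

open Descent using (descent; descent-parity; catalan≡descent)

descentS : ℕ → PS
descentS h n = + descent h n

descentS-0 : descentS 0 ≗ oneS
descentS-0 zero    = refl
descentS-0 (suc n) = refl

descentS-suc-⊛ : ∀ h g n → (descentS (suc h) ⊛ g) (suc n) ≡ (descentS (2 +ℕ h) ⊛ g) n + (descentS h ⊛ g) n
descentS-suc-⊛ h g n = begin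
  (descentS (suc h) ⊛ g) (suc n)                         ≡⟨ ⊛-suc-headless {descentS (suc h)} g n refl ⟩
  ((descentS (suc h) ∘ suc) ⊛ g) n                       ≡⟨ ⊛-congʳ g (λ i → ℤ.pos-+ (descent (2 +ℕ h) i) (descent h i)) n ⟩
  ((descentS (2 +ℕ h) ⊕ descentS h) ⊛ g) n               ≡⟨ ⊛-distribʳ g (descentS (2 +ℕ h)) (descentS h) n ⟩
  (descentS (2 +ℕ h) ⊛ g) n + (descentS h ⊛ g) n         ∎
  where open ≡-Reasoning

descentS-+ : ∀ h h′ → descentS (h +ℕ h′) ≗ (descentS h ⊛ descentS h′)
descentS-+ zero    h′ n       = sym (trans (⊛-congʳ (descentS h′) descentS-0 n) (⊛-identityˡ (descentS h′) n))
descentS-+ (suc h) h′ zero    = refl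
descentS-+ (suc h) h′ (suc n) = begin
  + (descent (2 +ℕ h +ℕ h′) n +ℕ descent (h +ℕ h′) n)                ≡⟨ ℤ.pos-+ (descent (2 +ℕ h +ℕ h′) n) (descent (h +ℕ h′) n) ⟩
  descentS (2 +ℕ h +ℕ h′) n + descentS (h +ℕ h′) n                    ≡⟨ cong₂ _+_ (descentS-+ (2 +ℕ h) h′ n) (descentS-+ h h′ n) ⟩
  (descentS (2 +ℕ h) ⊛ descentS h′) n + (descentS h ⊛ descentS h′) n  ≡⟨ descentS-suc-⊛ h (descentS h′) n ⟨
  (descentS (suc h) ⊛ descentS h′) (suc n)                            ∎
  where open ≡-Reasoning

descentS-1-fixpoint : descentS 1 ≗ (xS ⊕ (xS ⊛ (descentS 1 ⊛ descentS 1)))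
descentS-1-fixpoint = ≗-head-tail xS (descentS 1 ⊛ descentS 1) refl λ n → begin
  + (descent 2 n +ℕ descent 0 n)                 ≡⟨ ℤ.pos-+ (descent 2 n) (descent 0 n) ⟩
  descentS 2 n + descentS 0 n                     ≡⟨ ℤ.+-comm (descentS 2 n) (descentS 0 n) ⟩
  descentS 0 n + descentS 2 n                     ≡⟨ cong₂ _+_ (trans (descentS-0 n) (sym (xS-suc n))) (descentS-+ 1 1 n) ⟩
  xS (suc n) + (descentS 1 ⊛ descentS 1) n        ∎
  where open ≡-Reasoning

descentS-1≗xS⊛dilate-Cat : descentS 1 ≗ (xS ⊛ dilate Cat)
descentS-1≗xS⊛dilate-Cat = ≗-xS⊛ refl (≗-dilate even odd)
  where
  even : ∀ a → + descent 1 (suc (2 *ℕ a)) ≡ Cat a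
  even a = cong +_ (sym (catalan≡descent a))
  1ℙ≢0ℙ : 1ℙ ≢ 0ℙ
  1ℙ≢0ℙ ()
  odd : ∀ a → + descent 1 (suc (suc (2 *ℕ a))) ≡ + 0
  odd a = cong +_ (descent-parity 1 (2 +ℕ 2 *ℕ a) λ 1≡even → 1ℙ≢0ℙ (trans 1≡even (Parity.*-homo-* 2 a)))

Cat-fixpoint : Cat ≗ (oneS ⊕ (xS ⊛ (Cat ⊛ Cat)))
Cat-fixpoint = dilate-injective (xS⊛-cancel (begin
  xS ⊛ dilate Cat                                            ≈⟨ descentS-1≗xS⊛dilate-Cat ⟨
  descentS 1                                                 ≈⟨ descentS-1-fixpoint ⟩
  xS ⊕ (xS ⊛ (descentS 1 ⊛ descentS 1))                      ≈⟨ PS.+-congˡ {xS} (PS.*-congˡ {xS} (PS.*-cong descentS-1≗xS⊛dilate-Cat descentS-1≗xS⊛dilate-Cat)) ⟩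
  xS ⊕ (xS ⊛ ((xS ⊛ dilate Cat) ⊛ (xS ⊛ dilate Cat)))        ≈⟨ solve 2 (λ x c → x :+ x :* ((x :* c) :* (x :* c)) := x :* (con (+ 1) :+ x :* ((x :* c) :* c)))
                                                                       (λ _ → refl) xS (dilate Cat) ⟩
  xS ⊛ (oneS ⊕ (xS ⊛ ((xS ⊛ dilate Cat) ⊛ dilate Cat)))      ≈⟨ PS.*-congˡ {xS} (dilate-1+x⊛ Cat Cat) ⟨
  xS ⊛ dilate (oneS ⊕ (xS ⊛ (Cat ⊛ Cat)))                    ∎))
  where open ≗-Reasoning

uu-head : ∀ j → uu (suc j) 0 ≡ + 1
uu-head zero    = refl
uu-head (suc j) = cong (_- (xS ⊛ uu j) 0) (uu-head j)

R-1 : R 1 ≗ oneS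
R-1 = PS.sym (⊘-unique {oneS} {uu 2} {oneS} refl λ n → trans (⊛-identityˡ (uu 2) n) (uu-2 n))
  where
  uu-2 : uu 2 ≗ oneS
  uu-2 n = trans (cong (_-_ (oneS n)) (trans (⊛-comm xS zeroS n) (⊛-zeroˡ xS n))) (ℤ.+-identityʳ (oneS n))

R-fixpoint : ∀ j → R (2 +ℕ j) ≗ (oneS ⊕ (xS ⊛ (R (suc j) ⊛ R (2 +ℕ j))))
R-fixpoint j = PS.sym (⊘-unique (uu-head (2 +ℕ j)) (begin
  (oneS ⊕ (xS ⊛ (r₁ ⊛ r₂))) ⊛ u₃           ≈⟨ solve 4 (λ x r₁ r₂ u₃ → (con (+ 1) :+ x :* (r₁ :* r₂)) :* u₃ := u₃ :+ x :* (r₁ :* (r₂ :* u₃)))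
                                                     (λ _ → refl) xS r₁ r₂ u₃ ⟩
  u₃ ⊕ (xS ⊛ (r₁ ⊛ (r₂ ⊛ u₃)))              ≈⟨ PS.+-congˡ {u₃} (PS.*-congˡ {xS} (PS.*-congˡ {r₁} (⊘-cancel {u₂} {u₃} (uu-head (2 +ℕ j))))) ⟩
  u₃ ⊕ (xS ⊛ (r₁ ⊛ u₂))                     ≈⟨ PS.+-congˡ {u₃} (PS.*-congˡ {xS} (⊘-cancel {u₁} {u₂} (uu-head (suc j)))) ⟩
  u₃ ⊕ (xS ⊛ u₁)                            ≈⟨ solve 3 (λ x u₁ u₂ → (u₂ :- x :* u₁) :+ x :* u₁ := u₂) (λ _ → refl) xS u₁ u₂ ⟩
  u₂                                        ∎))
  where
  open ≗-Reasoning
  u₁ = uu (suc j)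
  u₂ = uu (2 +ℕ j)
  u₃ = uu (3 +ℕ j)
  r₁ = R (suc j)
  r₂ = R (2 +ℕ j)

rhs-fixpoint : ∀ k → rhs k ≗ (oneS ⊕ (xS ⊛ ((Cat ⊕ (R (suc k) ⊝ oneS)) ⊛ rhs k)))
rhs-fixpoint k = PS.sym (⊘-unique {Cat} {D} refl (begin
  (oneS ⊕ (xS ⊛ ((Cat ⊕ h) ⊛ r))) ⊛ D        ≈⟨ solve 5 (λ x c h r d → (con (+ 1) :+ x :* ((c :+ h) :* r)) :* d := d :+ x :* ((c :+ h) :* (r :* d)))
                                                       (λ _ → refl) xS Cat h r D ⟩
  D ⊕ (xS ⊛ ((Cat ⊕ h) ⊛ (r ⊛ D)))            ≈⟨ PS.+-congˡ {D} (PS.*-congˡ {xS} (PS.*-congˡ {Cat ⊕ h} (⊘-cancel {Cat} {D} refl))) ⟩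
  D ⊕ (xS ⊛ ((Cat ⊕ h) ⊛ Cat))                ≈⟨ solve 3 (λ x c h → (con (+ 1) :- (x :* h) :* c) :+ x :* ((c :+ h) :* c) := con (+ 1) :+ x :* (c :* c))
                                                       (λ _ → refl) xS Cat h ⟩
  oneS ⊕ (xS ⊛ (Cat ⊛ Cat))                   ≈⟨ Cat-fixpoint ⟨
  Cat                                         ∎))
  where
  open ≗-Reasoning
  h = R (suc k) ⊝ oneS
  D = oneS ⊝ ((xS ⊛ h) ⊛ Cat)
  r = rhs k

-- Counting paths

countTrue-++ : ∀ xs ys → countTrue (xs ++ ys) ≡ countTrue xs +ℕ countTrue ys
countTrue-++ []           ys = refl
countTrue-++ (true ∷ xs)  ys = cong suc (countTrue-++ xs ys)
countTrue-++ (false ∷ xs) ys = countTrue-++ xs ys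

countTrue-guarded : ∀ c (P : List Bool → Bool) ws →
                    + countTrue (map (λ s → not c ∧ P s) ws) ≡ (if c then + 0 else + countTrue (map P ws))
countTrue-guarded true  P []       = refl
countTrue-guarded true  P (_ ∷ ws) = countTrue-guarded true P ws
countTrue-guarded false P ws       = refl

≡ᵇ-false : ∀ {m n} → m ≢ n → (m ≡ᵇ n) ≡ false
≡ᵇ-false {m} {n} = dec-false (m ℕ.≟ n)

≡ᵇ-refl : ∀ n → (n ≡ᵇ n) ≡ true
≡ᵇ-refl n = dec-true (n ℕ.≟ n) refl

-- The state of a path is its height together with whether its last step was a down-step;
-- valleys are forbidden at height k.
module _ (k : ℕ) where

  stepDown : (ℕ → Bool → ℤ) → ℕ → ℤ
  stepDown F zero    = + 0
  stepDown F (suc h) = F h true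

  step : (ℕ → Bool → ℤ) → ℕ → Bool → ℤ
  step F h d = (if d ∧ (h ≡ᵇ k) then + 0 else F (suc h) false) + stepDown F h

  walks : ℕ → Bool → PS
  walks h d n = + countTrue (map (admissible k h d) (allWords n))

  walks-suc : ∀ h d n → walks h d (suc n) ≡ step (λ h′ d′ → walks h′ d′ n) h d
  walks-suc h d n = begin
    + countTrue (map P (map (true ∷_) ws ++ map (false ∷_) ws))
      ≡⟨ cong (+_ ∘ countTrue) (map-++ P (map (true ∷_) ws) (map (false ∷_) ws)) ⟩
    + countTrue (map P (map (true ∷_) ws) ++ map P (map (false ∷_) ws))
      ≡⟨ cong +_ (countTrue-++ (map P (map (true ∷_) ws)) (map P (map (false ∷_) ws))) ⟩
    + (countTrue (map P (map (true ∷_) ws)) +ℕ countTrue (map P (map (false ∷_) ws)))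
      ≡⟨ ℤ.pos-+ (countTrue (map P (map (true ∷_) ws))) (countTrue (map P (map (false ∷_) ws))) ⟩
    + countTrue (map P (map (true ∷_) ws)) + + countTrue (map P (map (false ∷_) ws))
      ≡⟨ cong₂ (λ u v → + countTrue u + + countTrue v) (sym (map-∘ ws)) (sym (map-∘ ws)) ⟩
    + countTrue (map (P ∘ (true ∷_)) ws) + + countTrue (map (P ∘ (false ∷_)) ws)
      ≡⟨ cong₂ _+_ (countTrue-guarded (d ∧ (h ≡ᵇ k)) (admissible k (suc h) false) ws) (down h d) ⟩
    step (λ h′ d′ → walks h′ d′ n) h d ∎
    where
    open ≡-Reasoning
    P  = admissible k h d
    ws = allWords n
    down : ∀ h d → + countTrue (map (admissible k h d ∘ (false ∷_)) ws) ≡ stepDown (λ h′ d′ → walks h′ d′ n) h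
    down zero    d = countTrue-guarded true (λ _ → true) ws
    down (suc h) d = refl

  walks-zero : ∀ {h} d → h ≢ suc k → walks h d 0 ≡ + 0
  walks-zero d h≢1+k rewrite ≡ᵇ-false h≢1+k = refl

  step-cong : ∀ {F G} h d → F (suc h) false ≡ G (suc h) false → stepDown F h ≡ stepDown G h → step F h d ≡ step G h d
  step-cong h d = cong₂ (λ u v → (if d ∧ (h ≡ᵇ k) then + 0 else u) + v)

  step-irrelevant : ∀ F {h} d → h ≢ k → step F h d ≡ step F h false
  step-irrelevant F d h≢k rewrite ≡ᵇ-false h≢k | ∧-zeroʳ d = refl

  step-⊛ : ∀ (F : ℕ → ℕ → Bool → ℤ) X h d n →
           ((λ i → step (F i) h d) ⊛ X) n ≡ step (λ h′ d′ → ((λ i → F i h′ d′) ⊛ X) n) h d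
  step-⊛ F X h d n = trans (⊛-distribʳ X (λ i → if d ∧ (h ≡ᵇ k) then + 0 else F i (suc h) false) (λ i → stepDown (F i) h) n)
                           (cong₂ _+_ (⊛-guarded (d ∧ (h ≡ᵇ k)) (λ i → F i (suc h) false) X n) (down h))
    where
    down : ∀ h → ((λ i → stepDown (F i) h) ⊛ X) n ≡ stepDown (λ h′ d′ → ((λ i → F i h′ d′) ⊛ X) n) h
    down zero    = ⊛-zeroˡ X n
    down (suc h) = refl

  walks-irrelevant : ∀ {h} d → h ≢ k → walks h d ≗ walks h false
  walks-irrelevant     d h≢k zero    = refl
  walks-irrelevant {h} d h≢k (suc n) = begin
    walks h d (suc n)                        ≡⟨ walks-suc h d n ⟩
    step (λ h′ d′ → walks h′ d′ n) h d       ≡⟨ step-irrelevant (λ h′ d′ → walks h′ d′ n) d h≢k ⟩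
    step (λ h′ d′ → walks h′ d′ n) h false   ≡⟨ walks-suc h false n ⟨
    walks h false (suc n)                    ∎
    where open ≡-Reasoning

  -- ascent L h d n counts the n-step paths from state (h, d) that reach height L for the first time at their end.
  ascent : ℕ → ℕ → Bool → PS
  ascent L h d zero    = if h ≡ᵇ L then + 1 else + 0
  ascent L h d (suc n) = if h ≡ᵇ L then + 0 else step (λ h′ d′ → ascent L h′ d′ n) h d

  ascent-self : ∀ L d → ascent L L d ≗ oneS
  ascent-self L d zero    rewrite ≡ᵇ-refl L = refl
  ascent-self L d (suc n) rewrite ≡ᵇ-refl L = refl

  ascent-zero : ∀ {L h} d → h ≢ L → ascent L h d 0 ≡ + 0
  ascent-zero d h≢L rewrite ≡ᵇ-false h≢L = refl

  ascent-suc : ∀ {L h} d n → h ≢ L → ascent L h d (suc n) ≡ step (λ h′ d′ → ascent L h′ d′ n) h d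
  ascent-suc d n h≢L rewrite ≡ᵇ-false h≢L = refl

  ascent-irrelevant : ∀ {L h} d → h ≢ k → ascent L h d ≗ ascent L h false
  ascent-irrelevant         d h≢k zero = refl
  ascent-irrelevant {L} {h} d h≢k (suc n) with h ≡ᵇ L
  ... | true  = refl
  ... | false = step-irrelevant (λ h′ d′ → ascent L h′ d′ n) d h≢k

  -- A path from below M that ends at M is a first ascent to M followed by a path from M.
  ascent-decomposition : ∀ M (Y : ℕ → Bool → PS) →
    (∀ {h} d n → h < M → Y h d (suc n) ≡ step (λ h′ d′ → Y h′ d′ n) h d) →
    (∀ {h} d → h < M → Y h d 0 ≡ + 0) →
    ∀ {h} d → h < M → Y h d ≗ (ascent M h d ⊛ Y M false)
  ascent-decomposition M Y Y-suc Y-zero = decompose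
    where
    decompose : ∀ {h} d → h < M → Y h d ≗ (ascent M h d ⊛ Y M false)
    decompose d h<M zero    = trans (Y-zero d h<M) (sym (cong (λ a → a * Y M false 0 + + 0) (ascent-zero d (ℕ.<⇒≢ h<M))))
    decompose {h} d h<M (suc n) = begin
      Y h d (suc n)                                                   ≡⟨ Y-suc d n h<M ⟩
      step (λ h′ d′ → Y h′ d′ n) h d                                  ≡⟨ step-cong h d up (down h h<M) ⟩
      step (λ h′ d′ → (ascent M h′ d′ ⊛ Y M false) n) h d             ≡⟨ step-⊛ (λ i h′ d′ → ascent M h′ d′ i) (Y M false) h d n ⟨
      ((λ i → step (λ h′ d′ → ascent M h′ d′ i) h d) ⊛ Y M false) n   ≡⟨ ⊛-congʳ (Y M false) (λ i → ascent-suc d i (ℕ.<⇒≢ h<M)) n ⟨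
      ((ascent M h d ∘ suc) ⊛ Y M false) n                            ≡⟨ ⊛-suc-headless {ascent M h d} (Y M false) n (ascent-zero d (ℕ.<⇒≢ h<M)) ⟨
      (ascent M h d ⊛ Y M false) (suc n)                              ∎
      where
      open ≡-Reasoning
      up : Y (suc h) false n ≡ (ascent M (suc h) false ⊛ Y M false) n
      up with ℕ.m≤n⇒m<n∨m≡n h<M
      ... | inj₁ 1+h<M = decompose false 1+h<M n
      ... | inj₂ refl  = sym (trans (⊛-congʳ (Y M false) (ascent-self M false) n) (⊛-identityˡ (Y M false) n))
      down : ∀ h → h < M → stepDown (λ h′ d′ → Y h′ d′ n) h ≡ stepDown (λ h′ d′ → (ascent M h′ d′ ⊛ Y M false) n) h
      down zero     _   = refl
      down (suc h′) h<M = decompose true (ℕ.<-trans (ℕ.n<1+n h′) h<M) n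

  -- Above k no valley is forbidden, so a path from h + k + 1 first descends h levels without constraint.
  walks-above : ∀ h d → walks (h +ℕ suc k) d ≗ (descentS h ⊛ walks (suc k) false)
  walks-above zero    d n       = begin
    walks (suc k) d n                         ≡⟨ walks-irrelevant d ℕ.1+n≢n n ⟩
    walks (suc k) false n                     ≡⟨ ⊛-identityˡ (walks (suc k) false) n ⟨
    (oneS ⊛ walks (suc k) false) n            ≡⟨ ⊛-congʳ (walks (suc k) false) descentS-0 n ⟨
    (descentS 0 ⊛ walks (suc k) false) n      ∎
    where open ≡-Reasoning
  walks-above (suc h) d zero    = walks-zero d (ℕ.>⇒≢ (s≤s (ℕ.m≤n+m (suc k) h)))
  walks-above (suc h) d (suc n) = begin
    walks (suc h +ℕ suc k) d (suc n)                                         ≡⟨ walks-irrelevant d (ℕ.>⇒≢ (s≤s (ℕ.m≤n⇒m≤o+n h (ℕ.n≤1+n k)))) (suc n) ⟩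
    walks (suc h +ℕ suc k) false (suc n)                                     ≡⟨ walks-suc (suc h +ℕ suc k) false n ⟩
    walks (2 +ℕ h +ℕ suc k) false n + walks (h +ℕ suc k) true n              ≡⟨ cong₂ _+_ (walks-above (2 +ℕ h) false n) (walks-above h true n) ⟩
    (descentS (2 +ℕ h) ⊛ walks (suc k) false) n + (descentS h ⊛ walks (suc k) false) n ≡⟨ descentS-suc-⊛ h (walks (suc k) false) n ⟨
    (descentS (suc h) ⊛ walks (suc k) false) (suc n)                         ∎
    where open ≡-Reasoning

  walks-split : ∀ {h} d → h < suc k → walks h d ≗ (ascent (suc k) h d ⊛ walks (suc k) false)
  walks-split = ascent-decomposition (suc k) walks (λ {h} d n _ → walks-suc h d n) (λ d h<1+k → walks-zero d (ℕ.<⇒≢ h<1+k))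

  ascent-split : ∀ {M L h} d → M < L → h < M → ascent L h d ≗ (ascent M h d ⊛ ascent L M false)
  ascent-split {M} {L} d M<L = ascent-decomposition M (ascent L)
    (λ d n h<M → ascent-suc d n (ℕ.<⇒≢ (ℕ.<-trans h<M M<L)))
    (λ d h<M → ascent-zero d (ℕ.<⇒≢ (ℕ.<-trans h<M M<L)))
    d

  walks-fixpoint : walks (suc k) false ≗ (oneS ⊕ (xS ⊛ ((descentS 1 ⊕ ascent (suc k) k true) ⊛ walks (suc k) false)))
  walks-fixpoint = ≗-head-tail oneS ((descentS 1 ⊕ ascent (suc k) k true) ⊛ walks (suc k) false)
                               (cong (λ b → + countTrue (b ∷ [])) (≡ᵇ-refl k)) λ n → begin
    walks (suc k) false (suc n)                                                    ≡⟨ walks-suc (suc k) false n ⟩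
    walks (2 +ℕ k) false n + walks k true n                                        ≡⟨ cong₂ _+_ (walks-above 1 false n) (walks-split true (ℕ.n<1+n k) n) ⟩
    (descentS 1 ⊛ W) n + (ascent (suc k) k true ⊛ W) n                             ≡⟨ ⊛-distribʳ W (descentS 1) (ascent (suc k) k true) n ⟨
    ((descentS 1 ⊕ ascent (suc k) k true) ⊛ W) n                                   ≡⟨ ℤ.+-identityˡ _ ⟨
    + 0 + ((descentS 1 ⊕ ascent (suc k) k true) ⊛ W) n                             ∎
    where
    open ≡-Reasoning
    W = walks (suc k) false

  ascent-bottom : ascent 1 0 false ≗ xS
  ascent-bottom zero    = refl
  ascent-bottom (suc n) = trans (ℤ.+-identityʳ _) (trans (ascent-self 1 false n) (sym (xS-suc n)))

  ascent-fixpoint : ∀ j → j < k →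
    ascent (2 +ℕ j) (suc j) false ≗ (xS ⊕ (xS ⊛ (ascent (suc j) j false ⊛ ascent (2 +ℕ j) (suc j) false)))
  ascent-fixpoint j j<k = ≗-head-tail xS (ascent (suc j) j false ⊛ S₂) (ascent-zero {h = suc j} false (ℕ.1+n≢n ∘ sym)) λ n → begin
    ascent (2 +ℕ j) (suc j) false (suc n)                                     ≡⟨ ascent-suc false n (ℕ.1+n≢n ∘ sym) ⟩
    ascent (2 +ℕ j) (2 +ℕ j) false n + ascent (2 +ℕ j) j true n               ≡⟨ cong₂ _+_ (trans (ascent-self (2 +ℕ j) false n) (sym (xS-suc n)))
                                                                                           (ascent-split true (ℕ.n<1+n (suc j)) (ℕ.n<1+n j) n) ⟩
    xS (suc n) + (ascent (suc j) j true ⊛ S₂) n                               ≡⟨ cong (_+_ (xS (suc n))) (⊛-congʳ S₂ (ascent-irrelevant true (ℕ.<⇒≢ j<k)) n) ⟩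
    xS (suc n) + (ascent (suc j) j false ⊛ S₂) n                              ∎
    where
    open ≡-Reasoning
    S₂ = ascent (2 +ℕ j) (suc j) false

  -- From (k, true) the up-step would create a forbidden valley; from (k, false) it reaches k + 1 at once.
  ascent-top : ascent (suc k) k false ≗ (xS ⊕ ascent (suc k) k true)
  ascent-top zero    = sym (ℤ.+-identityˡ _)
  ascent-top (suc n) = begin
    ascent (suc k) k false (suc n)                 ≡⟨ ascent-suc false n k≢1+k ⟩
    ascent (suc k) (suc k) false n + D             ≡⟨ cong₂ _+_ (trans (ascent-self (suc k) false n) (sym (xS-suc n))) (sym (ℤ.+-identityˡ D)) ⟩
    xS (suc n) + (+ 0 + D)                         ≡⟨ cong (λ b → xS (suc n) + ((if b then + 0 else ascent (suc k) (suc k) false n) + D)) (≡ᵇ-refl k) ⟨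
    xS (suc n) + step (λ h′ d′ → ascent (suc k) h′ d′ n) k true ≡⟨ cong (_+_ (xS (suc n))) (ascent-suc true n k≢1+k) ⟨
    xS (suc n) + ascent (suc k) k true (suc n)     ∎
    where
    open ≡-Reasoning
    k≢1+k = ℕ.1+n≢n ∘ sym
    D = stepDown (λ h′ d′ → ascent (suc k) h′ d′ n) k

  ascent≗R : ∀ j → j ≤ k → ascent (suc j) j false ≗ (xS ⊛ dilate (R (suc j)))
  ascent≗R zero    _    = begin
    ascent 1 0 false              ≈⟨ ascent-bottom ⟩
    xS                            ≈⟨ PS.*-identityʳ xS ⟨
    xS ⊛ oneS                     ≈⟨ PS.*-congˡ {xS} (PS.trans (dilate-cong R-1) dilate-oneS) ⟨
    xS ⊛ dilate (R 1)             ∎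
    where open ≗-Reasoning
  ascent≗R (suc j) 1+j≤k = xS⊛-fixpoint-unique xS (ascent (suc j) j false) (ascent-fixpoint j 1+j≤k) (begin
    xS ⊛ dilate r₂                                        ≈⟨ PS.*-congˡ {xS} (dilate-cong (R-fixpoint j)) ⟩
    xS ⊛ dilate (oneS ⊕ (xS ⊛ (r₁ ⊛ r₂)))                 ≈⟨ PS.*-congˡ {xS} (dilate-1+x⊛ r₁ r₂) ⟩
    xS ⊛ (oneS ⊕ (xS ⊛ ((xS ⊛ dilate r₁) ⊛ dilate r₂)))   ≈⟨ solve 3 (λ x s t → x :* (con (+ 1) :+ x :* (s :* t)) := x :+ x :* (s :* (x :* t)))
                                                                     (λ _ → refl) xS (xS ⊛ dilate r₁) (dilate r₂) ⟩
    xS ⊕ (xS ⊛ ((xS ⊛ dilate r₁) ⊛ (xS ⊛ dilate r₂)))     ≈⟨ PS.+-congˡ {xS} (PS.*-congˡ {xS} (PS.*-congʳ {xS ⊛ dilate r₂}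
                                                                (ascent≗R j (ℕ.≤-trans (ℕ.n≤1+n j) 1+j≤k)))) ⟨
    xS ⊕ (xS ⊛ (ascent (suc j) j false ⊛ (xS ⊛ dilate r₂))) ∎)
    where
    open ≗-Reasoning
    r₁ = R (suc j)
    r₂ = R (2 +ℕ j)

  ascent-valley : ascent (suc k) k true ≗ (xS ⊛ dilate (R (suc k) ⊝ oneS))
  ascent-valley = begin
    H                                      ≈⟨ solve 2 (λ x h → h := (x :+ h) :- x) (λ _ → refl) xS H ⟩
    (xS ⊕ H) ⊝ xS                          ≈⟨ PS.+-congʳ ascent-top ⟨
    ascent (suc k) k false ⊝ xS            ≈⟨ PS.+-congʳ (ascent≗R k ℕ.≤-refl) ⟩
    (xS ⊛ dilate r) ⊝ xS                   ≈⟨ solve 2 (λ x d → x :* d :- x := x :* (d :- con (+ 1))) (λ _ → refl) xS (dilate r) ⟩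
    xS ⊛ (dilate r ⊝ oneS)                 ≈⟨ PS.*-congˡ {xS} (PS.+-congˡ {dilate r} (PS.-‿cong dilate-oneS)) ⟨
    xS ⊛ (dilate r ⊝ dilate oneS)          ≈⟨ PS.*-congˡ {xS} (dilate-⊝ r oneS) ⟨
    xS ⊛ dilate (r ⊝ oneS)                 ∎
    where
    open ≗-Reasoning
    H = ascent (suc k) k true
    r = R (suc k)

  walks≗dilate-rhs : walks (suc k) false ≗ dilate (rhs k)
  walks≗dilate-rhs = xS⊛-fixpoint-unique oneS (descentS 1 ⊕ ascent (suc k) k true) walks-fixpoint (begin
    dilate (rhs k)                                                 ≈⟨ dilate-cong (rhs-fixpoint k) ⟩
    dilate (oneS ⊕ (xS ⊛ (E ⊛ rhs k)))                             ≈⟨ dilate-1+x⊛ E (rhs k) ⟩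
    oneS ⊕ (xS ⊛ ((xS ⊛ dilate E) ⊛ dilate (rhs k)))               ≈⟨ PS.+-congˡ {oneS} (PS.*-congˡ {xS} (PS.*-congʳ {dilate (rhs k)} steps)) ⟨
    oneS ⊕ (xS ⊛ ((descentS 1 ⊕ ascent (suc k) k true) ⊛ dilate (rhs k))) ∎)
    where
    open ≗-Reasoning
    E = Cat ⊕ (R (suc k) ⊝ oneS)
    steps : (descentS 1 ⊕ ascent (suc k) k true) ≗ (xS ⊛ dilate E)
    steps = begin
      descentS 1 ⊕ ascent (suc k) k true                             ≈⟨ PS.+-cong descentS-1≗xS⊛dilate-Cat ascent-valley ⟩
      (xS ⊛ dilate Cat) ⊕ (xS ⊛ dilate (R (suc k) ⊝ oneS))           ≈⟨ PS.distribˡ xS (dilate Cat) (dilate (R (suc k) ⊝ oneS)) ⟨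
      xS ⊛ (dilate Cat ⊕ dilate (R (suc k) ⊝ oneS))                  ≈⟨ PS.*-congˡ {xS} (dilate-⊕ Cat (R (suc k) ⊝ oneS)) ⟨
      xS ⊛ dilate E                                                  ∎

mainTheorem3 : (k m : ℕ) → + b k m ≡ rhs k m
mainTheorem3 k m = begin
  + b k m                           ≡⟨⟩
  walks k (suc k) false (2 *ℕ m)    ≡⟨ walks≗dilate-rhs k (2 *ℕ m) ⟩
  dilate (rhs k) (2 *ℕ m)           ≡⟨ dilate-even (rhs k) m ⟩
  rhs k m                           ∎
  where open ≡-Reasoning
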